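{- Let $m\geq0$ and $a=2^m$. Let $(B_a(n))_{n\ge1}$ and $(C_a(n))_{n\ge1}$ be the elements of $B_a$ and $C_a$ listed in increasing order, and set $\beta_a(n)=t(B_a(n))$, $\gamma_a(n)=t(C_a(n))$. Then the sequence $(\gamma_a(n))_{n\ge1}$ is periodic with minimal period of length $2^{m+1}$, and it is the periodic repetition of the block $1-t(0),1-t(1),\dots,1-t(2^{m+1}-1)$ (that is, $\gamma_a(n)=1-t(n-1)$ for $1\le n\le 2^{m+1}$); moreover $\beta_a(n)+\gamma_a(n)=1$ for all $n\ge1$.
   Context: $\mathbb{N}_0=\{0,1,2,\dots\}$. $t(n)$ is the Thue–Morse sequence: $t(n)=0$ if the binary expansion of $n$ has an even number of $1$'s, $t(n)=1$ otherwise. For $a\ge1$, $B_a=\{x\in\mathbb{N}_0: t(x+a)=1-t(x)\}$ and $C_a=\{x\in\mathbb{N}_0: t(x+a)=t(x)\}$. -}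

module Defs where

open import Data.Nat using (ℕ; zero; suc; _+_; _∸_; _%_; _/_; _≡ᵇ_)
open import Data.Bool using (Bool; if_then_else_)
open import Data.Product using (_×_)
open import Relation.Binary.PropositionalEquality using (_≡_)

-- Number of 1's in the binary expansion of n, computed with "fuel":
-- binOnes f n sums the lowest f binary digits of n.  Since n < 2^n,
-- fuel n suffices to read all binary digits of n.
binOnes : ℕ → ℕ → ℕ
binOnes zero    n = 0
binOnes (suc f) n = n % 2 + binOnes f (n / 2)

t : ℕ → ℕ
t n = binOnes n n % 2

inB : ℕ → ℕ → Bool
inB a x = t (x + a) ≡ᵇ (1 ∸ t x)

inC : ℕ → ℕ → Bool
inC a x = t (x + a) ≡ᵇ t x

count : (ℕ → Bool) → ℕ → ℕ
count P zero    = 0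
count P (suc x) = count P x + (if P x then 1 else 0)

-- Nth P n x : x is the n-th element (1-indexed, n ≥ 1) of the set
-- {y : P y} listed in increasing order, i.e. P x holds and exactly
-- n - 1 elements of the set are smaller than x.
Nth : (ℕ → Bool) → ℕ → ℕ → Set
Nth P n x = (P x ≡ Data.Bool.true) × (count P x ≡ n ∸ 1)

-- Let M = 2a and cut ℕ into blocks [qM, qM + M).  Digit splitting,
-- t(c·2^j + s) = t(c) + t(s) (mod 2) for s < 2^j, shows that the lower half of
-- block q lies in B_a, while its upper half lies entirely in C_a if t jumps
-- between q and q + 1, and entirely in B_a otherwise.  So below qM there are
-- a·#jumps(q) elements of C_a and a·(q + #non-jumps(q)) elements of B_a, and by
-- telescoping both multipliers have parity t(q).  Comparing with
-- G(k) = t(k mod M), computed by the same digit splitting, gives for x in C_a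
-- that t(x) = 1 - G(#C_a below x), and for x in B_a that t(x) = G(#B_a below x);
-- that is, γ_a(n) = 1 - G(n-1) and β_a(n) = G(n-1).  Every claim then follows
-- from three properties of G: period M, no smaller period, G = t on [0, M).
module Submission where

open import Defs
open import Data.Nat using (ℕ; zero; suc; _+_; _*_; _∸_; _^_; _≤_; _<_; z≤n; s≤s; _%_; _/_; _≡ᵇ_; _<?_; _≤?_; NonZero; ⌊_/2⌋; ⌈_/2⌉; parity)
open import Data.Nat.Properties
open import Data.Nat.DivMod using (m/n≡1+[m∸n]/n; m≡m%n+[m/n]*n; m%n<n)
open import Data.Parity.Base using (Parity; 0ℙ; 1ℙ; _⁻¹) renaming (_+_ to _⊕_)
open import Data.Parity.Properties using (⁻¹-involutive; p+p≡0ℙ; p≢p⁻¹; p⁻¹+p≡1ℙ; ⁻¹-injective)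
  renaming (+-homo-+ to parity-homo-+; +-identityʳ to ⊕-identityʳ)
open import Data.Product using (_×_; ∃; _,_)
open import Data.Bool using (Bool; true; false; not; if_then_else_)
open import Data.Bool.Properties using (not-involutive)
open import Data.Empty using (⊥-elim)
open import Relation.Binary.PropositionalEquality
open import Relation.Nullary using (¬_; yes; no)
open import Data.Nat.Solver using (module +-*-Solver)
open +-*-Solver using (solve; _:+_; _:*_; _:=_; con)

-- Parity of the number of 1's among the lowest j binary digits of k,
-- i.e. the Thue–Morse value of k mod 2^j.
tmMod : ℕ → ℕ → Parity
tmMod zero    k = 0ℙ
tmMod (suc j) k = parity k ⊕ tmMod j ⌊ k /2⌋

-- The Thue–Morse sequence with values in Parity (k < 2^k, so k digits suffice).
tm : ℕ → Parity
tm k = tmMod k k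

toℕ : Parity → ℕ
toℕ 0ℙ = 0
toℕ 1ℙ = 1

n%2≡toℕ-parity : ∀ n → n % 2 ≡ toℕ (parity n)
n%2≡toℕ-parity zero          = refl
n%2≡toℕ-parity (suc zero)    = refl
n%2≡toℕ-parity (suc (suc n)) = n%2≡toℕ-parity n

n/2≡⌊n/2⌋ : ∀ n → n / 2 ≡ ⌊ n /2⌋
n/2≡⌊n/2⌋ zero          = refl
n/2≡⌊n/2⌋ (suc zero)    = refl
n/2≡⌊n/2⌋ (suc (suc n)) = trans (m/n≡1+[m∸n]/n {suc (suc n)} {2} (s≤s (s≤s z≤n))) (cong suc (n/2≡⌊n/2⌋ n))

parity-toℕ : ∀ p → parity (toℕ p) ≡ p
parity-toℕ 0ℙ = refl
parity-toℕ 1ℙ = refl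

binOnes-parity : ∀ f n → parity (binOnes f n) ≡ tmMod f n
binOnes-parity zero    n = refl
binOnes-parity (suc f) n = begin
  parity (n % 2 + binOnes f (n / 2))          ≡⟨ parity-homo-+ (n % 2) _ ⟩
  parity (n % 2) ⊕ parity (binOnes f (n / 2)) ≡⟨ cong₂ _⊕_ parity-n%2 (binOnes-parity f (n / 2)) ⟩
  parity n ⊕ tmMod f (n / 2)                  ≡⟨ cong (λ h → parity n ⊕ tmMod f h) (n/2≡⌊n/2⌋ n) ⟩
  parity n ⊕ tmMod f ⌊ n /2⌋                  ∎
  where
  open ≡-Reasoning
  parity-n%2 : parity (n % 2) ≡ parity n
  parity-n%2 = trans (cong parity (n%2≡toℕ-parity n)) (parity-toℕ (parity n))

t≡toℕ∘tm : ∀ n → t n ≡ toℕ (tm n)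
t≡toℕ∘tm n = trans (n%2≡toℕ-parity (binOnes n n)) (cong toℕ (binOnes-parity n n))

data Halving : ℕ → Set where
  even : ∀ y → Halving (y + y)
  odd  : ∀ y → Halving (suc (y + y))

halving : ∀ k → Halving k
halving zero = even 0
halving (suc k) with halving k
... | even y = odd y
... | odd y  = subst Halving (cong suc (+-suc y y)) (even (suc y))

halve-< : ∀ {y n} → y + y < 2 * n → y < n
halve-< {y} {n} h = *-cancelˡ-< 2 y n (subst (_< 2 * n) (cong (y +_) (sym (+-identityʳ y))) h)

halve-odd-< : ∀ {y n} → suc (y + y) < 2 * n → y < n
halve-odd-< h = halve-< (<-trans (n<1+n _) h)

parity-double : ∀ y → parity (y + y) ≡ 0ℙ
parity-double y = trans (parity-homo-+ y y) (p+p≡0ℙ (parity y))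

tmMod-even : ∀ j y → tmMod (suc j) (y + y) ≡ tmMod j y
tmMod-even j y = begin
  parity (y + y) ⊕ tmMod j ⌊ y + y /2⌋ ≡⟨ cong₂ _⊕_ (parity-double y) (cong (tmMod j) (sym (n≡⌊n+n/2⌋ y))) ⟩
  tmMod j y                            ∎
  where open ≡-Reasoning

tmMod-odd : ∀ j y → tmMod (suc j) (suc (y + y)) ≡ tmMod j y ⁻¹
tmMod-odd j y = begin
  parity (suc (y + y)) ⊕ tmMod j ⌈ y + y /2⌉ ≡⟨ cong₂ _⊕_ parity-odd (cong (tmMod j) (sym (n≡⌈n+n/2⌉ y))) ⟩
  1ℙ ⊕ tmMod j y                             ∎
  where
  open ≡-Reasoning
  parity-odd : parity (suc (y + y)) ≡ 1ℙ
  parity-odd = trans (parity-homo-+ 1 (y + y)) (cong _⁻¹ (parity-double y))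

⁻¹-distribʳ-⊕ : ∀ p q → (p ⊕ q) ⁻¹ ≡ p ⊕ q ⁻¹
⁻¹-distribʳ-⊕ 0ℙ q = refl
⁻¹-distribʳ-⊕ 1ℙ q = refl

tmMod-split : ∀ j i c s → s < 2 ^ j → tmMod (j + i) (c * 2 ^ j + s) ≡ tmMod i c ⊕ tmMod j s
tmMod-split zero i c zero _ =
  trans (cong (tmMod i) (trans (+-identityʳ _) (*-identityʳ c))) (sym (⊕-identityʳ _))
tmMod-split zero i c (suc s) (s≤s ())
tmMod-split (suc j) i c s s< with halving s
... | even y = begin
  tmMod (suc (j + i)) (c * 2 ^ suc j + (y + y)) ≡⟨ cong (tmMod (suc (j + i))) (shift-even c (2 ^ j) y) ⟩
  tmMod (suc (j + i)) (z + z)                   ≡⟨ tmMod-even (j + i) z ⟩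
  tmMod (j + i) z                               ≡⟨ tmMod-split j i c y (halve-< s<) ⟩
  tmMod i c ⊕ tmMod j y                         ≡⟨ cong (tmMod i c ⊕_) (sym (tmMod-even j y)) ⟩
  tmMod i c ⊕ tmMod (suc j) (y + y)             ∎
  where
  open ≡-Reasoning
  z = c * 2 ^ j + y
  shift-even : ∀ c X y → c * (2 * X) + (y + y) ≡ (c * X + y) + (c * X + y)
  shift-even = solve 3 (λ c X y → c :* (con 2 :* X) :+ (y :+ y) := (c :* X :+ y) :+ (c :* X :+ y)) refl
... | odd y = begin
  tmMod (suc (j + i)) (c * 2 ^ suc j + suc (y + y)) ≡⟨ cong (tmMod (suc (j + i))) (shift-odd c (2 ^ j) y) ⟩
  tmMod (suc (j + i)) (suc (z + z))                 ≡⟨ tmMod-odd (j + i) z ⟩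
  tmMod (j + i) z ⁻¹                                ≡⟨ cong _⁻¹ (tmMod-split j i c y (halve-odd-< s<)) ⟩
  (tmMod i c ⊕ tmMod j y) ⁻¹                        ≡⟨ ⁻¹-distribʳ-⊕ (tmMod i c) (tmMod j y) ⟩
  tmMod i c ⊕ tmMod j y ⁻¹                          ≡⟨ cong (tmMod i c ⊕_) (sym (tmMod-odd j y)) ⟩
  tmMod i c ⊕ tmMod (suc j) (suc (y + y))           ∎
  where
  open ≡-Reasoning
  z = c * 2 ^ j + y
  shift-odd : ∀ c X y → c * (2 * X) + suc (y + y) ≡ suc ((c * X + y) + (c * X + y))
  shift-odd = solve 3 (λ c X y → c :* (con 2 :* X) :+ (con 1 :+ (y :+ y)) := con 1 :+ ((c :* X :+ y) :+ (c :* X :+ y))) refl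

tmMod-0 : ∀ i → tmMod i 0 ≡ 0ℙ
tmMod-0 zero    = refl
tmMod-0 (suc i) = tmMod-0 i

tmMod-stable : ∀ j i k → k < 2 ^ j → tmMod (j + i) k ≡ tmMod j k
tmMod-stable j i k k< = trans (tmMod-split j i 0 k k<) (cong (_⊕ tmMod j k) (tmMod-0 i))

n<2^n : ∀ n → n < 2 ^ n
n<2^n zero    = s≤s z≤n
n<2^n (suc n) = ≤-<-trans (n<2^n n) (m<m+n (2 ^ n) (<-≤-trans (m^n>0 2 n) (m≤m+n (2 ^ n) 0)))

tmMod-low : ∀ j k → k < 2 ^ j → tmMod j k ≡ tm k
tmMod-low j k k< = begin
  tmMod j k       ≡⟨ sym (tmMod-stable j k k k<) ⟩
  tmMod (j + k) k ≡⟨ cong (λ f → tmMod f k) (+-comm j k) ⟩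
  tmMod (k + j) k ≡⟨ tmMod-stable k j k (n<2^n k) ⟩
  tm k            ∎
  where open ≡-Reasoning

-- A number with c in front of j appended digits is below 2^(j+c), since 1 + c ≤ 2^c.
append-< : ∀ j c s → s < 2 ^ j → c * 2 ^ j + s < 2 ^ (j + c)
append-< j c s s< = begin-strict
  c * 2 ^ j + s     <⟨ +-monoʳ-< (c * 2 ^ j) s< ⟩
  c * 2 ^ j + 2 ^ j ≡⟨ +-comm (c * 2 ^ j) (2 ^ j) ⟩
  suc c * 2 ^ j     ≤⟨ *-monoˡ-≤ (2 ^ j) (n<2^n c) ⟩
  2 ^ c * 2 ^ j     ≡⟨ *-comm (2 ^ c) (2 ^ j) ⟩
  2 ^ j * 2 ^ c     ≡⟨ sym (^-distribˡ-+-* 2 j c) ⟩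
  2 ^ (j + c)       ∎
  where open ≤-Reasoning

tm-split : ∀ j c s → s < 2 ^ j → tm (c * 2 ^ j + s) ≡ tm c ⊕ tm s
tm-split j c s s< = begin
  tm (c * 2 ^ j + s)               ≡⟨ sym (tmMod-low (j + c) _ (append-< j c s s<)) ⟩
  tmMod (j + c) (c * 2 ^ j + s)    ≡⟨ tmMod-split j c c s s< ⟩
  tmMod c c ⊕ tmMod j s            ≡⟨ cong (tm c ⊕_) (tmMod-low j s s<) ⟩
  tm c ⊕ tm s                      ∎
  where open ≡-Reasoning

double-< : ∀ {y n} → y < n → suc (y + y) < 2 * n
double-< {y} {n} y<n = begin-strict
  suc (y + y)     <⟨ n<1+n _ ⟩
  suc (suc y + y) ≡⟨ cong suc (sym (+-suc y y)) ⟩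
  suc y + suc y   ≤⟨ +-mono-≤ y<n y<n ⟩
  n + n           ≡⟨ cong (n +_) (sym (+-identityʳ n)) ⟩
  2 * n           ∎
  where open ≤-Reasoning

tm-double : ∀ y → tm (y + y) ≡ tm y
tm-double y = begin
  tm (y + y)            ≡⟨ sym (tmMod-low (suc y) (y + y) (<-trans (n<1+n _) (double-< (n<2^n y)))) ⟩
  tmMod (suc y) (y + y) ≡⟨ tmMod-even y y ⟩
  tm y                  ∎
  where open ≡-Reasoning

tm-double+1 : ∀ y → tm (suc (y + y)) ≡ tm y ⁻¹
tm-double+1 y = begin
  tm (suc (y + y))            ≡⟨ sym (tmMod-low (suc y) (suc (y + y)) (double-< (n<2^n y))) ⟩
  tmMod (suc y) (suc (y + y)) ≡⟨ tmMod-odd y y ⟩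
  tm y ⁻¹                     ∎
  where open ≡-Reasoning

tmMod-periodic : ∀ j k → tmMod j (k + 2 ^ j) ≡ tmMod j k
tmMod-periodic zero    k = refl
tmMod-periodic (suc j) k with halving k
... | even y = begin
  tmMod (suc j) ((y + y) + 2 * 2 ^ j)             ≡⟨ cong (tmMod (suc j)) (shift-even y (2 ^ j)) ⟩
  tmMod (suc j) ((y + 2 ^ j) + (y + 2 ^ j))       ≡⟨ tmMod-even j (y + 2 ^ j) ⟩
  tmMod j (y + 2 ^ j)                             ≡⟨ tmMod-periodic j y ⟩
  tmMod j y                                       ≡⟨ sym (tmMod-even j y) ⟩
  tmMod (suc j) (y + y)                           ∎
  where
  open ≡-Reasoning
  shift-even : ∀ y X → (y + y) + 2 * X ≡ (y + X) + (y + X)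
  shift-even = solve 2 (λ y X → (y :+ y) :+ con 2 :* X := (y :+ X) :+ (y :+ X)) refl
... | odd y = begin
  tmMod (suc j) (suc (y + y) + 2 * 2 ^ j)         ≡⟨ cong (tmMod (suc j)) (shift-odd y (2 ^ j)) ⟩
  tmMod (suc j) (suc ((y + 2 ^ j) + (y + 2 ^ j))) ≡⟨ tmMod-odd j (y + 2 ^ j) ⟩
  tmMod j (y + 2 ^ j) ⁻¹                          ≡⟨ cong _⁻¹ (tmMod-periodic j y) ⟩
  tmMod j y ⁻¹                                    ≡⟨ sym (tmMod-odd j y) ⟩
  tmMod (suc j) (suc (y + y))                     ∎
  where
  open ≡-Reasoning
  shift-odd : ∀ y X → suc (y + y) + 2 * X ≡ suc ((y + X) + (y + X))
  shift-odd = solve 2 (λ y X → (con 1 :+ (y :+ y)) :+ con 2 :* X := con 1 :+ ((y :+ X) :+ (y :+ X))) refl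

-- An odd shift is never a period of tmMod (j+1): comparing even and odd
-- arguments, f = tmMod j would satisfy f y ≡ f (y+q) ⁻¹ and f y ⁻¹ ≡ f (y+q+1),
-- so f is constant from q on, while f q ≡ f (q+q) ⁻¹.
no-odd-period : ∀ j q → ¬ (∀ k → tmMod (suc j) k ≡ tmMod (suc j) (k + suc (q + q)))
no-odd-period j q period = p≢p⁻¹ (f q) (trans (flips q) (cong _⁻¹ (constant q)))
  where
  f = tmMod j
  flips : ∀ y → f y ≡ f (y + q) ⁻¹
  flips y = begin
    f y                                ≡⟨ sym (tmMod-even j y) ⟩
    tmMod (suc j) (y + y)              ≡⟨ period (y + y) ⟩
    tmMod (suc j) ((y + y) + suc (q + q)) ≡⟨ cong (tmMod (suc j)) (shape y q) ⟩
    tmMod (suc j) (suc ((y + q) + (y + q))) ≡⟨ tmMod-odd j (y + q) ⟩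
    f (y + q) ⁻¹                       ∎
    where
    open ≡-Reasoning
    shape : ∀ y q → (y + y) + suc (q + q) ≡ suc ((y + q) + (y + q))
    shape = solve 2 (λ y q → (y :+ y) :+ (con 1 :+ (q :+ q)) := con 1 :+ ((y :+ q) :+ (y :+ q))) refl
  flips-back : ∀ y → f y ⁻¹ ≡ f (suc (y + q))
  flips-back y = begin
    f y ⁻¹                                  ≡⟨ sym (tmMod-odd j y) ⟩
    tmMod (suc j) (suc (y + y))             ≡⟨ period (suc (y + y)) ⟩
    tmMod (suc j) (suc (y + y) + suc (q + q)) ≡⟨ cong (tmMod (suc j)) (shape y q) ⟩
    tmMod (suc j) (suc (y + q) + suc (y + q)) ≡⟨ tmMod-even j (suc (y + q)) ⟩
    f (suc (y + q))                         ∎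
    where
    open ≡-Reasoning
    shape : ∀ y q → suc (y + y) + suc (q + q) ≡ suc (y + q) + suc (y + q)
    shape = solve 2 (λ y q → (con 1 :+ (y :+ y)) :+ (con 1 :+ (q :+ q)) := (con 1 :+ (y :+ q)) :+ (con 1 :+ (y :+ q))) refl
  constant : ∀ i → f (i + q) ≡ f q
  constant zero    = refl
  constant (suc i) = begin
    f (suc (i + q))   ≡⟨ sym (flips-back i) ⟩
    f i ⁻¹            ≡⟨ cong _⁻¹ (flips i) ⟩
    f (i + q) ⁻¹ ⁻¹   ≡⟨ ⁻¹-involutive (f (i + q)) ⟩
    f (i + q)         ≡⟨ constant i ⟩
    f q               ∎
    where open ≡-Reasoning

-- 2^j is the least period of tmMod j: an even period 2q of tmMod (j+1)
-- gives the period q of tmMod j, and odd periods are impossible.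
tmMod-minimal-period : ∀ j p → 0 < p → p < 2 ^ j → ¬ (∀ k → tmMod j k ≡ tmMod j (k + p))
tmMod-minimal-period zero    (suc p) _ (s≤s ())
tmMod-minimal-period (suc j) p 0<p p< period with halving p
... | odd q  = no-odd-period j q period
... | even q = tmMod-minimal-period j q (half-pos q 0<p) (halve-< p<) halved
  where
  half-pos : ∀ q → 0 < q + q → 0 < q
  half-pos (suc q) _ = s≤s z≤n
  halved : ∀ k → tmMod j k ≡ tmMod j (k + q)
  halved k = begin
    tmMod j k                         ≡⟨ sym (tmMod-even j k) ⟩
    tmMod (suc j) (k + k)             ≡⟨ period (k + k) ⟩
    tmMod (suc j) ((k + k) + (q + q)) ≡⟨ cong (tmMod (suc j)) (shape k q) ⟩
    tmMod (suc j) ((k + q) + (k + q)) ≡⟨ tmMod-even j (k + q) ⟩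
    tmMod j (k + q)                   ∎
    where
    open ≡-Reasoning
    shape : ∀ k q → (k + k) + (q + q) ≡ (k + q) + (k + q)
    shape = solve 2 (λ k q → (k :+ k) :+ (q :+ q) := (k :+ q) :+ (k :+ q)) refl

count-none : ∀ P u s → (∀ i → i < s → P (u + i) ≡ false) → count P (u + s) ≡ count P u
count-none P u zero    _    = cong (count P) (+-identityʳ u)
count-none P u (suc s) none = begin
  count P (u + suc s)                            ≡⟨ cong (count P) (+-suc u s) ⟩
  count P (u + s) + (if P (u + s) then 1 else 0) ≡⟨ cong (λ b → count P (u + s) + (if b then 1 else 0)) (none s (n<1+n s)) ⟩
  count P (u + s) + 0                            ≡⟨ +-identityʳ _ ⟩
  count P (u + s)                                ≡⟨ count-none P u s (λ i i<s → none i (m<n⇒m<1+n i<s)) ⟩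
  count P u                                      ∎
  where open ≡-Reasoning

count-all : ∀ P u s → (∀ i → i < s → P (u + i) ≡ true) → count P (u + s) ≡ count P u + s
count-all P u zero    _   = trans (cong (count P) (+-identityʳ u)) (sym (+-identityʳ _))
count-all P u (suc s) all = begin
  count P (u + suc s)                            ≡⟨ cong (count P) (+-suc u s) ⟩
  count P (u + s) + (if P (u + s) then 1 else 0) ≡⟨ cong (λ b → count P (u + s) + (if b then 1 else 0)) (all s (n<1+n s)) ⟩
  count P (u + s) + 1                            ≡⟨ cong (_+ 1) (count-all P u s (λ i i<s → all i (m<n⇒m<1+n i<s))) ⟩
  count P u + s + 1                              ≡⟨ +-assoc (count P u) s 1 ⟩
  count P u + (s + 1)                            ≡⟨ cong (count P u +_) (+-comm s 1) ⟩
  count P u + suc s                              ∎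
  where open ≡-Reasoning

-- If at least n elements of P lie below X, then the n-th element exists:
-- it is the last y < X at which the count is still below n.
nth-exists : ∀ P n X → 1 ≤ n → n ≤ count P X → ∃ λ x → Nth P n x
nth-exists P n       zero    1≤n n≤0 = ⊥-elim (<⇒≱ 1≤n n≤0)
nth-exists P (suc k) (suc X) 1≤n n≤  with suc k ≤? count P X
... | yes n≤count = nth-exists P (suc k) X 1≤n n≤count
... | no  n≰count with P X in PX
...   | true  = X , PX , ≤-antisym (≤-pred (≰⇒> n≰count)) (≤-pred (subst (suc k ≤_) (+-comm (count P X) 1) n≤))
...   | false = ⊥-elim (n≰count (subst (suc k ≤_) (+-identityʳ _) n≤))

toℕ-⁻¹ : ∀ p → toℕ (p ⁻¹) ≡ 1 ∸ toℕ p
toℕ-⁻¹ 0ℙ = refl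
toℕ-⁻¹ 1ℙ = refl

toℕ+toℕ⁻¹ : ∀ p → toℕ p + toℕ (p ⁻¹) ≡ 1
toℕ+toℕ⁻¹ 0ℙ = refl
toℕ+toℕ⁻¹ 1ℙ = refl

toℕ-injective : ∀ {p q} → toℕ p ≡ toℕ q → p ≡ q
toℕ-injective {0ℙ} {0ℙ} _ = refl
toℕ-injective {1ℙ} {1ℙ} _ = refl

isOne : Parity → Bool
isOne 0ℙ = false
isOne 1ℙ = true

isOne-⁻¹ : ∀ p → isOne (p ⁻¹) ≡ not (isOne p)
isOne-⁻¹ 0ℙ = refl
isOne-⁻¹ 1ℙ = refl

parity-indicator : ∀ p → parity (if isOne p then 1 else 0) ≡ p
parity-indicator 0ℙ = refl
parity-indicator 1ℙ = refl

inB-tm : ∀ a x → inB a x ≡ isOne (tm (x + a) ⊕ tm x)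
inB-tm a x = trans (cong₂ (λ u v → u ≡ᵇ (1 ∸ v)) (t≡toℕ∘tm (x + a)) (t≡toℕ∘tm x)) (differ (tm (x + a)) (tm x))
  where
  differ : ∀ u v → (toℕ u ≡ᵇ (1 ∸ toℕ v)) ≡ isOne (u ⊕ v)
  differ 0ℙ 0ℙ = refl
  differ 0ℙ 1ℙ = refl
  differ 1ℙ 0ℙ = refl
  differ 1ℙ 1ℙ = refl

inC-tm : ∀ a x → inC a x ≡ not (isOne (tm (x + a) ⊕ tm x))
inC-tm a x = trans (cong₂ _≡ᵇ_ (t≡toℕ∘tm (x + a)) (t≡toℕ∘tm x)) (agree (tm (x + a)) (tm x))
  where
  agree : ∀ u v → (toℕ u ≡ᵇ toℕ v) ≡ not (isOne (u ⊕ v))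
  agree 0ℙ 0ℙ = refl
  agree 0ℙ 1ℙ = refl
  agree 1ℙ 0ℙ = refl
  agree 1ℙ 1ℙ = refl

module Blocks (m : ℕ) where

  a M : ℕ
  a = 2 ^ m
  M = 2 ^ suc m

  instance
    a-nonZero : NonZero a
    a-nonZero = m^n≢0 2 m
    M-nonZero : NonZero M
    M-nonZero = m^n≢0 2 (suc m)

  B C : ℕ → Bool
  B = inB a
  C = inC a

  G : ℕ → Parity
  G = tmMod (suc m)

  jump : ℕ → Bool
  jump q = isOne (tm (suc q) ⊕ tm q)

  data Position : ℕ → Set where
    lower : ∀ q s → s < a → Position (q * M + s)
    upper : ∀ q s → s < a → Position ((q * M + a) + s)

  position : ∀ x → Position x
  position x with x % M <? a
  ... | yes r<a = subst Position x≡ (lower (x / M) (x % M) r<a)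
    where
    x≡ : x / M * M + x % M ≡ x
    x≡ = trans (+-comm _ (x % M)) (sym (m≡m%n+[m/n]*n x M))
  ... | no r≮a = subst Position x≡ (upper (x / M) (x % M ∸ a) s<a)
    where
    a≤r : a ≤ x % M
    a≤r = ≮⇒≥ r≮a
    s<a : x % M ∸ a < a
    s<a = m<n+o⇒m∸n<o (x % M) a (subst (x % M <_) (cong (a +_) (+-identityʳ a)) (m%n<n x M))
    x≡ : (x / M * M + a) + (x % M ∸ a) ≡ x
    x≡ = begin
      (x / M * M + a) + (x % M ∸ a) ≡⟨ +-assoc (x / M * M) a _ ⟩
      x / M * M + (a + (x % M ∸ a)) ≡⟨ cong (x / M * M +_) (m+[n∸m]≡n a≤r) ⟩
      x / M * M + x % M             ≡⟨ +-comm _ (x % M) ⟩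
      x % M + x / M * M             ≡⟨ sym (m≡m%n+[m/n]*n x M) ⟩
      x                             ∎
      where open ≡-Reasoning

  lower-< : ∀ {s} → s < a → s < M
  lower-< s<a = <-≤-trans s<a (m≤m+n a _)

  upper-< : ∀ {s} → s < a → a + s < M
  upper-< s<a = +-monoʳ-< a (<-≤-trans s<a (m≤m+n a 0))

  tm-lower : ∀ q s → s < a → tm (q * M + s) ≡ tm q ⊕ tm s
  tm-lower q s s<a = tm-split (suc m) q s (lower-< s<a)

  tm-upper : ∀ q s → s < a → tm ((q * M + a) + s) ≡ tm q ⊕ tm s ⁻¹
  tm-upper q s s<a = begin
    tm ((q * M + a) + s)  ≡⟨ cong tm (+-assoc (q * M) a s) ⟩
    tm (q * M + (a + s))  ≡⟨ tm-split (suc m) q (a + s) (upper-< s<a) ⟩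
    tm q ⊕ tm (a + s)     ≡⟨ cong (λ y → tm q ⊕ tm (y + s)) (sym (*-identityˡ a)) ⟩
    tm q ⊕ tm (1 * a + s) ≡⟨ cong (tm q ⊕_) (tm-split m 1 s s<a) ⟩
    tm q ⊕ tm s ⁻¹        ∎
    where open ≡-Reasoning

  tm-upper+a : ∀ q s → s < a → tm (((q * M + a) + s) + a) ≡ tm (suc q) ⊕ tm s
  tm-upper+a q s s<a = trans (cong tm (next-block q a s)) (tm-lower (suc q) s s<a)
    where
    next-block : ∀ q a s → ((q * (2 * a) + a) + s) + a ≡ (1 + q) * (2 * a) + s
    next-block = solve 3 (λ q a s → ((q :* (con 2 :* a) :+ a) :+ s) :+ a := (con 1 :+ q) :* (con 2 :* a) :+ s) refl

  lower-differs : ∀ q s → s < a → isOne (tm ((q * M + s) + a) ⊕ tm (q * M + s)) ≡ true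
  lower-differs q s s<a = cong isOne (begin
    tm ((q * M + s) + a) ⊕ tm (q * M + s)  ≡⟨ cong₂ _⊕_ (cong tm (swap (q * M) s a)) (tm-lower q s s<a) ⟩
    tm ((q * M + a) + s) ⊕ (tm q ⊕ tm s)   ≡⟨ cong (_⊕ (tm q ⊕ tm s)) (tm-upper q s s<a) ⟩
    (tm q ⊕ tm s ⁻¹) ⊕ (tm q ⊕ tm s)       ≡⟨ flip-one (tm q) (tm s) ⟩
    1ℙ                                     ∎)
    where
    open ≡-Reasoning
    swap : ∀ x s a → (x + s) + a ≡ (x + a) + s
    swap = solve 3 (λ x s a → (x :+ s) :+ a := (x :+ a) :+ s) refl
    flip-one : ∀ u v → (u ⊕ v ⁻¹) ⊕ (u ⊕ v) ≡ 1ℙ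
    flip-one 0ℙ 0ℙ = refl
    flip-one 0ℙ 1ℙ = refl
    flip-one 1ℙ 0ℙ = refl
    flip-one 1ℙ 1ℙ = refl

  upper-differs : ∀ q s → s < a → isOne (tm (((q * M + a) + s) + a) ⊕ tm ((q * M + a) + s)) ≡ not (jump q)
  upper-differs q s s<a = begin
    isOne (tm (((q * M + a) + s) + a) ⊕ tm ((q * M + a) + s)) ≡⟨ cong isOne (cong₂ _⊕_ (tm-upper+a q s s<a) (tm-upper q s s<a)) ⟩
    isOne ((tm (suc q) ⊕ tm s) ⊕ (tm q ⊕ tm s ⁻¹))            ≡⟨ cong isOne (cancel (tm (suc q)) (tm q) (tm s)) ⟩
    isOne ((tm (suc q) ⊕ tm q) ⁻¹)                            ≡⟨ isOne-⁻¹ (tm (suc q) ⊕ tm q) ⟩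
    not (jump q)                                              ∎
    where
    open ≡-Reasoning
    cancel : ∀ u v w → (u ⊕ w) ⊕ (v ⊕ w ⁻¹) ≡ (u ⊕ v) ⁻¹
    cancel 0ℙ 0ℙ 0ℙ = refl
    cancel 0ℙ 0ℙ 1ℙ = refl
    cancel 0ℙ 1ℙ 0ℙ = refl
    cancel 0ℙ 1ℙ 1ℙ = refl
    cancel 1ℙ 0ℙ 0ℙ = refl
    cancel 1ℙ 0ℙ 1ℙ = refl
    cancel 1ℙ 1ℙ 0ℙ = refl
    cancel 1ℙ 1ℙ 1ℙ = refl

  B-lower : ∀ q s → s < a → B (q * M + s) ≡ true
  B-lower q s s<a = trans (inB-tm a (q * M + s)) (lower-differs q s s<a)

  C-lower : ∀ q s → s < a → C (q * M + s) ≡ false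
  C-lower q s s<a = trans (inC-tm a (q * M + s)) (cong not (lower-differs q s s<a))

  B-upper : ∀ q s → s < a → B ((q * M + a) + s) ≡ not (jump q)
  B-upper q s s<a = trans (inB-tm a ((q * M + a) + s)) (upper-differs q s s<a)

  C-upper : ∀ q s → s < a → C ((q * M + a) + s) ≡ jump q
  C-upper q s s<a = trans (inC-tm a ((q * M + a) + s)) (trans (cong not (upper-differs q s s<a)) (not-involutive (jump q)))

  C-count-lower : ∀ q → count C (q * M + a) ≡ count C (q * M)
  C-count-lower q = count-none C (q * M) a (C-lower q)

  B-count-lower : ∀ q s → s ≤ a → count B (q * M + s) ≡ count B (q * M) + s
  B-count-lower q s s≤a = count-all B (q * M) s (λ i i<s → B-lower q i (<-≤-trans i<s s≤a))

  C-count-jump : ∀ q → jump q ≡ true → ∀ s → s ≤ a → count C ((q * M + a) + s) ≡ count C (q * M) + s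
  C-count-jump q jq s s≤a = trans (count-all C (q * M + a) s (λ i i<s → trans (C-upper q i (<-≤-trans i<s s≤a)) jq))
                                  (cong (_+ s) (C-count-lower q))

  C-count-steady : ∀ q → jump q ≡ false → count C ((q * M + a) + a) ≡ count C (q * M)
  C-count-steady q jq = trans (count-none C (q * M + a) a (λ i i<a → trans (C-upper q i i<a) jq)) (C-count-lower q)

  B-count-jump : ∀ q → jump q ≡ true → count B ((q * M + a) + a) ≡ count B (q * M) + a
  B-count-jump q jq = trans (count-none B (q * M + a) a (λ i i<a → trans (B-upper q i i<a) (cong not jq)))
                            (B-count-lower q a ≤-refl)

  B-count-steady : ∀ q → jump q ≡ false → ∀ s → s ≤ a → count B ((q * M + a) + s) ≡ (count B (q * M) + a) + s
  B-count-steady q jq s s≤a = trans (count-all B (q * M + a) s (λ i i<s → trans (B-upper q i (<-≤-trans i<s s≤a)) (cong not jq)))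
                                    (cong (_+ s) (B-count-lower q a ≤-refl))

  block-end : ∀ q → suc q * M ≡ (q * M + a) + a
  block-end q = shape q a
    where
    shape : ∀ q a → (1 + q) * (2 * a) ≡ (q * (2 * a) + a) + a
    shape = solve 2 (λ q a → (con 1 :+ q) :* (con 2 :* a) := (q :* (con 2 :* a) :+ a) :+ a) refl

  changes stays : ℕ → ℕ
  changes = count jump
  stays   = count (λ q → not (jump q))

  C-count-blocks : ∀ q → count C (q * M) ≡ changes q * a
  C-count-blocks zero = refl
  C-count-blocks (suc q) with jump q in jq
  ... | true = begin
    count C (suc q * M)         ≡⟨ cong (count C) (block-end q) ⟩
    count C ((q * M + a) + a)   ≡⟨ C-count-jump q jq a ≤-refl ⟩
    count C (q * M) + a         ≡⟨ cong (_+ a) (C-count-blocks q) ⟩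
    changes q * a + a           ≡⟨ shape (changes q) a ⟩
    (changes q + 1) * a         ∎
    where
    open ≡-Reasoning
    shape : ∀ c a → c * a + a ≡ (c + 1) * a
    shape = solve 2 (λ c a → c :* a :+ a := (c :+ con 1) :* a) refl
  ... | false = begin
    count C (suc q * M)         ≡⟨ cong (count C) (block-end q) ⟩
    count C ((q * M + a) + a)   ≡⟨ C-count-steady q jq ⟩
    count C (q * M)             ≡⟨ C-count-blocks q ⟩
    changes q * a               ≡⟨ cong (_* a) (sym (+-identityʳ (changes q))) ⟩
    (changes q + 0) * a         ∎
    where open ≡-Reasoning

  B-count-blocks : ∀ q → count B (q * M) ≡ (q + stays q) * a
  B-count-blocks zero = refl
  B-count-blocks (suc q) with jump q in jq
  ... | true = begin
    count B (suc q * M)             ≡⟨ cong (count B) (block-end q) ⟩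
    count B ((q * M + a) + a)       ≡⟨ B-count-jump q jq ⟩
    count B (q * M) + a             ≡⟨ cong (_+ a) (B-count-blocks q) ⟩
    (q + stays q) * a + a           ≡⟨ shape q (stays q) a ⟩
    (suc q + (stays q + 0)) * a     ∎
    where
    open ≡-Reasoning
    shape : ∀ q n a → (q + n) * a + a ≡ ((1 + q) + (n + 0)) * a
    shape = solve 3 (λ q n a → (q :+ n) :* a :+ a := ((con 1 :+ q) :+ (n :+ con 0)) :* a) refl
  ... | false = begin
    count B (suc q * M)             ≡⟨ cong (count B) (block-end q) ⟩
    count B ((q * M + a) + a)       ≡⟨ B-count-steady q jq a ≤-refl ⟩
    (count B (q * M) + a) + a       ≡⟨ cong (λ n → (n + a) + a) (B-count-blocks q) ⟩
    ((q + stays q) * a + a) + a     ≡⟨ shape q (stays q) a ⟩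
    (suc q + (stays q + 1)) * a     ∎
    where
    open ≡-Reasoning
    shape : ∀ q n a → ((q + n) * a + a) + a ≡ ((1 + q) + (n + 1)) * a
    shape = solve 3 (λ q n a → ((q :+ n) :* a :+ a) :+ a := ((con 1 :+ q) :+ (n :+ con 1)) :* a) refl

  -- Telescoping: t(q) = t(0) + #jumps = q + #non-jumps  (mod 2).
  changes-parity : ∀ q → parity (changes q) ≡ tm q
  changes-parity zero    = refl
  changes-parity (suc q) = begin
    parity (changes q + (if jump q then 1 else 0))          ≡⟨ parity-homo-+ (changes q) _ ⟩
    parity (changes q) ⊕ parity (if jump q then 1 else 0)   ≡⟨ cong₂ _⊕_ (changes-parity q) (parity-indicator _) ⟩
    tm q ⊕ (tm (suc q) ⊕ tm q)                              ≡⟨ cancel (tm q) (tm (suc q)) ⟩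
    tm (suc q)                                              ∎
    where
    open ≡-Reasoning
    cancel : ∀ v u → v ⊕ (u ⊕ v) ≡ u
    cancel 0ℙ 0ℙ = refl
    cancel 0ℙ 1ℙ = refl
    cancel 1ℙ 0ℙ = refl
    cancel 1ℙ 1ℙ = refl

  stays-parity : ∀ q → parity (q + stays q) ≡ tm q
  stays-parity zero    = refl
  stays-parity (suc q) = begin
    parity (suc q + (stays q + steady))                ≡⟨ cong (λ n → parity (suc n)) (sym (+-assoc q (stays q) steady)) ⟩
    parity (suc ((q + stays q) + steady))              ≡⟨ parity-homo-+ 1 ((q + stays q) + steady) ⟩
    parity ((q + stays q) + steady) ⁻¹                 ≡⟨ cong _⁻¹ (parity-homo-+ (q + stays q) steady) ⟩
    (parity (q + stays q) ⊕ parity steady) ⁻¹          ≡⟨ cong (λ p → (parity (q + stays q) ⊕ parity (if p then 1 else 0)) ⁻¹)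
                                                               (sym (isOne-⁻¹ (tm (suc q) ⊕ tm q))) ⟩
    (parity (q + stays q) ⊕ parity (if isOne ((tm (suc q) ⊕ tm q) ⁻¹) then 1 else 0)) ⁻¹
                                                       ≡⟨ cong₂ (λ u v → (u ⊕ v) ⁻¹) (stays-parity q) (parity-indicator _) ⟩
    (tm q ⊕ (tm (suc q) ⊕ tm q) ⁻¹) ⁻¹                 ≡⟨ cancel (tm q) (tm (suc q)) ⟩
    tm (suc q)                                         ∎
    where
    open ≡-Reasoning
    steady = if not (jump q) then 1 else 0
    cancel : ∀ v u → (v ⊕ (u ⊕ v) ⁻¹) ⁻¹ ≡ u
    cancel 0ℙ 0ℙ = refl
    cancel 0ℙ 1ℙ = refl
    cancel 1ℙ 0ℙ = refl
    cancel 1ℙ 1ℙ = refl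

  G-block : ∀ c s → s < a → G (c * a + s) ≡ parity c ⊕ tm s
  G-block c s s<a = begin
    tmMod (suc m) (c * a + s)   ≡⟨ cong (λ j → tmMod j (c * a + s)) (+-comm 1 m) ⟩
    tmMod (m + 1) (c * a + s)   ≡⟨ tmMod-split m 1 c s s<a ⟩
    (parity c ⊕ 0ℙ) ⊕ tmMod m s ≡⟨ cong₂ _⊕_ (⊕-identityʳ (parity c)) (tmMod-low m s s<a) ⟩
    parity c ⊕ tm s             ∎
    where open ≡-Reasoning

  C-value : ∀ x → C x ≡ true → tm x ≡ G (count C x) ⁻¹
  C-value x x∈C with position x
  ... | lower q s s<a = ⊥-elim (false≢true (trans (sym (C-lower q s s<a)) x∈C))
    where
    false≢true : false ≢ true
    false≢true ()
  ... | upper q s s<a = begin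
    tm ((q * M + a) + s)                   ≡⟨ tm-upper q s s<a ⟩
    tm q ⊕ tm s ⁻¹                         ≡⟨ sym (⁻¹-distribʳ-⊕ (tm q) (tm s)) ⟩
    (tm q ⊕ tm s) ⁻¹                       ≡⟨ cong (λ p → (p ⊕ tm s) ⁻¹) (sym (changes-parity q)) ⟩
    (parity (changes q) ⊕ tm s) ⁻¹         ≡⟨ cong _⁻¹ (sym (G-block (changes q) s s<a)) ⟩
    G (changes q * a + s) ⁻¹               ≡⟨ cong (λ n → G (n + s) ⁻¹) (sym (C-count-blocks q)) ⟩
    G (count C (q * M) + s) ⁻¹             ≡⟨ cong (λ n → G n ⁻¹) (sym (C-count-jump q jumps s (<⇒≤ s<a))) ⟩
    G (count C ((q * M + a) + s)) ⁻¹       ∎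
    where
    open ≡-Reasoning
    jumps : jump q ≡ true
    jumps = trans (sym (C-upper q s s<a)) x∈C

  B-value : ∀ x → B x ≡ true → tm x ≡ G (count B x)
  B-value x x∈B with position x
  ... | lower q s s<a = begin
    tm (q * M + s)                        ≡⟨ tm-lower q s s<a ⟩
    tm q ⊕ tm s                           ≡⟨ cong (_⊕ tm s) (sym (stays-parity q)) ⟩
    parity (q + stays q) ⊕ tm s           ≡⟨ sym (G-block (q + stays q) s s<a) ⟩
    G ((q + stays q) * a + s)             ≡⟨ cong (λ n → G (n + s)) (sym (B-count-blocks q)) ⟩
    G (count B (q * M) + s)               ≡⟨ cong G (sym (B-count-lower q s (<⇒≤ s<a))) ⟩
    G (count B (q * M + s))               ∎
    where open ≡-Reasoning
  ... | upper q s s<a = begin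
    tm ((q * M + a) + s)                  ≡⟨ tm-upper q s s<a ⟩
    tm q ⊕ tm s ⁻¹                        ≡⟨ swap (tm q) (tm s) ⟩
    tm q ⁻¹ ⊕ tm s                        ≡⟨ cong (λ p → p ⁻¹ ⊕ tm s) (sym (stays-parity q)) ⟩
    parity (q + stays q) ⁻¹ ⊕ tm s        ≡⟨ cong (_⊕ tm s) (sym (parity-homo-+ 1 (q + stays q))) ⟩
    parity (suc (q + stays q)) ⊕ tm s     ≡⟨ sym (G-block (suc (q + stays q)) s s<a) ⟩
    G (suc (q + stays q) * a + s)         ≡⟨ cong (λ n → G (n + s)) (+-comm a ((q + stays q) * a)) ⟩
    G (((q + stays q) * a + a) + s)       ≡⟨ cong (λ n → G ((n + a) + s)) (sym (B-count-blocks q)) ⟩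
    G ((count B (q * M) + a) + s)         ≡⟨ cong G (sym (B-count-steady q steady s (<⇒≤ s<a))) ⟩
    G (count B ((q * M + a) + s))         ∎
    where
    open ≡-Reasoning
    steady : jump q ≡ false
    steady = trans (sym (not-involutive (jump q))) (cong not (trans (sym (B-upper q s s<a)) x∈B))
    swap : ∀ u v → u ⊕ v ⁻¹ ≡ u ⁻¹ ⊕ v
    swap 0ℙ v = refl
    swap 1ℙ v = ⁻¹-involutive v

  -- There is a jump at every even position, since t(2y+1) = 1 - t(2y);
  -- hence C_a and B_a are infinite.
  jump-at-even : ∀ y → jump (y + y) ≡ true
  jump-at-even y = cong isOne (begin
    tm (suc (y + y)) ⊕ tm (y + y) ≡⟨ cong₂ _⊕_ (tm-double+1 y) (tm-double y) ⟩
    tm y ⁻¹ ⊕ tm y                ≡⟨ p⁻¹+p≡1ℙ (tm y) ⟩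
    1ℙ                            ∎)
    where open ≡-Reasoning

  changes-double : ∀ n → n ≤ changes (n + n)
  changes-double zero    = z≤n
  changes-double (suc n) = begin
    suc n                                                ≡⟨ +-comm 1 n ⟩
    n + 1                                                ≤⟨ +-monoˡ-≤ 1 (changes-double n) ⟩
    changes (n + n) + 1                                  ≡⟨ cong (λ b → changes (n + n) + (if b then 1 else 0)) (sym (jump-at-even n)) ⟩
    changes (suc (n + n))                                ≤⟨ m≤m+n _ _ ⟩
    changes (suc (suc (n + n)))                          ≡⟨ cong (λ k → changes (suc k)) (sym (+-suc n n)) ⟩
    changes (suc n + suc n)                              ∎
    where open ≤-Reasoning

  C-unbounded : ∀ n → n ≤ count C ((n + n) * M)
  C-unbounded n = begin
    n                       ≤⟨ changes-double n ⟩
    changes (n + n)         ≤⟨ m≤m*n (changes (n + n)) a ⟩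
    changes (n + n) * a     ≡⟨ sym (C-count-blocks (n + n)) ⟩
    count C ((n + n) * M)   ∎
    where open ≤-Reasoning

  B-unbounded : ∀ n → n ≤ count B (n * M)
  B-unbounded n = begin
    n                   ≤⟨ m≤m+n n (stays n) ⟩
    n + stays n         ≤⟨ m≤m*n (n + stays n) a ⟩
    (n + stays n) * a   ≡⟨ sym (B-count-blocks n) ⟩
    count B (n * M)     ∎
    where open ≤-Reasoning

  B-nth-exists : ∀ n → 1 ≤ n → ∃ λ x → Nth B n x
  B-nth-exists n 1≤n = nth-exists B n (n * M) 1≤n (B-unbounded n)

  C-nth-exists : ∀ n → 1 ≤ n → ∃ λ x → Nth C n x
  C-nth-exists n 1≤n = nth-exists C n ((n + n) * M) 1≤n (C-unbounded n)

  beta : ∀ n x → Nth B n x → t x ≡ toℕ (G (n ∸ 1))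
  beta n x (x∈B , below) = trans (t≡toℕ∘tm x) (cong toℕ (trans (B-value x x∈B) (cong G below)))

  gamma : ∀ n x → Nth C n x → t x ≡ toℕ (G (n ∸ 1) ⁻¹)
  gamma n x (x∈C , below) = trans (t≡toℕ∘tm x) (cong toℕ (trans (C-value x x∈C) (cong (λ k → G k ⁻¹) below)))

  gamma-periodic : ∀ n x y → 1 ≤ n → Nth C n x → Nth C (n + M) y → t x ≡ t y
  gamma-periodic n x y 1≤n x-nth y-nth = begin
    t x                           ≡⟨ gamma n x x-nth ⟩
    toℕ (G (n ∸ 1) ⁻¹)            ≡⟨ cong (λ k → toℕ (k ⁻¹)) (sym (tmMod-periodic (suc m) (n ∸ 1))) ⟩
    toℕ (G ((n ∸ 1) + M) ⁻¹)      ≡⟨ cong (λ k → toℕ (G k ⁻¹)) (sym (+-∸-comm M 1≤n)) ⟩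
    toℕ (G ((n + M) ∸ 1) ⁻¹)      ≡⟨ sym (gamma (n + M) y y-nth) ⟩
    t y                           ∎
    where open ≡-Reasoning

  -- A smaller period of γ_a would be a smaller period of G.
  gamma-minimal : ∀ p → 0 < p → p < M → ¬ (∀ n x y → 1 ≤ n → Nth C n x → Nth C (n + p) y → t x ≡ t y)
  gamma-minimal p 0<p p<M period = tmMod-minimal-period (suc m) p 0<p p<M G-period
    where
    G-period : ∀ k → G k ≡ G (k + p)
    G-period k with C-nth-exists (suc k) (s≤s z≤n) | C-nth-exists (suc k + p) (s≤s z≤n)
    ... | x , x-nth | y , y-nth = ⁻¹-injective (toℕ-injective (begin
      toℕ (G k ⁻¹)        ≡⟨ sym (gamma (suc k) x x-nth) ⟩
      t x                 ≡⟨ period (suc k) x y (s≤s z≤n) x-nth y-nth ⟩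
      t y                 ≡⟨ gamma (suc k + p) y y-nth ⟩
      toℕ (G (k + p) ⁻¹)  ∎))
      where open ≡-Reasoning

  -- On the first period, G agrees with t, so γ_a(n) = 1 - t(n-1).
  gamma-block : ∀ n x → 1 ≤ n → n ≤ M → Nth C n x → t x ≡ 1 ∸ t (n ∸ 1)
  gamma-block (suc k) x _ n≤M x-nth = begin
    t x                ≡⟨ gamma (suc k) x x-nth ⟩
    toℕ (G k ⁻¹)       ≡⟨ cong (λ p → toℕ (p ⁻¹)) (tmMod-low (suc m) k n≤M) ⟩
    toℕ (tm k ⁻¹)      ≡⟨ toℕ-⁻¹ (tm k) ⟩
    1 ∸ toℕ (tm k)     ≡⟨ cong (1 ∸_) (sym (t≡toℕ∘tm k)) ⟩
    1 ∸ t k            ∎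
    where open ≡-Reasoning

  beta+gamma : ∀ n x y → 1 ≤ n → Nth B n x → Nth C n y → t x + t y ≡ 1
  beta+gamma n x y _ x-nth y-nth =
    trans (cong₂ _+_ (beta n x x-nth) (gamma n y y-nth)) (toℕ+toℕ⁻¹ (G (n ∸ 1)))

corollary1 : (m : ℕ) →
    (∀ n → 1 ≤ n → ∃ λ x → Nth (inB (2 ^ m)) n x)
    × (∀ n → 1 ≤ n → ∃ λ x → Nth (inC (2 ^ m)) n x)
    × (∀ n x y → 1 ≤ n → Nth (inC (2 ^ m)) n x
         → Nth (inC (2 ^ m)) (n + 2 ^ (m + 1)) y → t x ≡ t y)
    × (∀ p → 0 < p → p < 2 ^ (m + 1) →
         ¬ (∀ n x y → 1 ≤ n → Nth (inC (2 ^ m)) n x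
              → Nth (inC (2 ^ m)) (n + p) y → t x ≡ t y))
    × (∀ n x → 1 ≤ n → n ≤ 2 ^ (m + 1) → Nth (inC (2 ^ m)) n x
         → t x ≡ 1 ∸ t (n ∸ 1))
    × (∀ n x y → 1 ≤ n → Nth (inB (2 ^ m)) n x → Nth (inC (2 ^ m)) n y
         → t x + t y ≡ 1)
corollary1 m rewrite +-comm m 1 =
  B-nth-exists , C-nth-exists , gamma-periodic , gamma-minimal , gamma-block , beta+gamma
  where open Blocks m
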